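{- Let $p$ be a prime, $f\ge1$, $q=p^f$, and $r_0,\dots,r_{f-1}\ge0$ with $r=r_0+pr_1+\cdots+p^{f-1}r_{f-1}\equiv a\pmod{q-1}$, $1\le a\le q-1$. Let $0\le m_i\le r_i$, $m=m_0+pm_1+\cdots+p^{f-1}m_{f-1}$ with $0\le m<r$, and let $1\le b\le q-1$. Put $S_{r,b,m}=\sum\binom{r_0}{l_0}\cdots\binom{r_{f-1}}{l_{f-1}}\binom{l_0}{m_0}\cdots\binom{l_{f-1}}{m_{f-1}}$, the sum over all $(l_0,\dots,l_{f-1})$ with $0\le l_i\le r_i$ and $l_0+pl_1+\cdots+p^{f-1}l_{f-1}\equiv b\pmod{q-1}$. Write $[b-m]=b'_0+pb'_1+\cdots+p^{f-1}b'_{f-1}$ in base $p$. Then $S_{r,b,m}\equiv\binom{r_0}{m_0}\cdots\binom{r_{f-1}}{m_{f-1}}\Big(\binom{[a-m]}{[b-m]}+\delta\Big)\pmod p$, where $\delta=1$ if $(b'_0,\dots,b'_{f-1})=(p-1,\dots,p-1)$ and $\delta=0$ otherwise.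
   Context: For an integer $n$, $[n]$ denotes the unique element of $\{1,2,\dots,q-1\}$ with $n\equiv[n]\pmod{q-1}$. -}

module Defs where

open import Data.Nat using (ℕ; zero; suc; _+_; _*_; _∸_; _^_; _/_; _%_)
open import Data.Nat.Divisibility using (_∣_; _∣?_)
open import Data.Nat.Combinatorics using (_C_)
open import Data.Integer as ℤ using (ℤ; +_; ∣_∣; _%ℕ_)
open import Data.Fin using (Fin; zero; suc; toℕ)
open import Data.Fin.Properties using (all?)
open import Data.List using (upTo; map)
open import Data.Nat.ListAction using (sum)
open import Data.Vec.Functional using (_∷_)
open import Data.Bool using (if_then_else_)
open import Relation.Nullary.Decidable using (⌊_⌋)
open import Relation.Binary.PropositionalEquality using (_≡_)
import Data.Nat as ℕ

_≡_[mod_] : ℕ → ℕ → ℕ → Set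
x ≡ y [mod n ] = n ∣ ∣ + x ℤ.- + y ∣

val : (p f : ℕ) → (Fin f → ℕ) → ℕ
val p zero    l = 0
val p (suc f) l = l zero + p * val p f (λ i → l (suc i))

prodFin : (f : ℕ) → (Fin f → ℕ) → ℕ
prodFin zero    g = 1
prodFin (suc f) g = g zero * prodFin f (λ i → g (suc i))

boxSum : (f : ℕ) → (Fin f → ℕ) → ((Fin f → ℕ) → ℕ) → ℕ
boxSum zero    r F = F (λ ())
boxSum (suc f) r F =
  sum (map (λ l₀ → boxSum f (λ i → r (suc i)) (λ l → F (l₀ ∷ l))) (upTo (suc (r zero))))

-- [n] : the unique element of {1,…,d} congruent to n mod d (d = q-1 ≥ 1);
-- junk value 0 when d = 0 (never used, since q ≥ 2)
bracket : ℕ → ℤ → ℕ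
bracket zero    n = 0
bracket (suc k) n = suc ((n ℤ.- ℤ.1ℤ) %ℕ suc k)

-- i-th base-p digit of n  (junk 0 when p = 0)
digit : ℕ → ℕ → ℕ → ℕ
digit zero    n i       = 0
digit (suc k) n zero    = n % suc k
digit (suc k) n (suc i) = digit (suc k) (n / suc k) i

delta : (p f n : ℕ) → ℕ
delta p f n = if ⌊ all? (λ (i : Fin f) → digit p n (toℕ i) ℕ.≟ p ∸ 1) ⌋ then 1 else 0

S : (p f : ℕ) → (r : Fin f → ℕ) → (b : ℕ) → (m : Fin f → ℕ) → ℕ
S p f r b m = boxSum f r (λ l →
  if ⌊ (p ^ f ∸ 1) ∣? ∣ + val p f l ℤ.- + b ∣ ⌋
  then prodFin f (λ i → r i C l i) * prodFin f (λ i → l i C m i)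
  else 0)

-- Write l = m + k digitwise. Since C(r, l) C(l, m) = C(r, m) C(r − m, k), S factors as
-- ∏ C(r_i, m_i) times Σ_k ∏ C(s_i, k_i) w(k₀ + p k₁ + ⋯), where s = r − m and
-- w(j) = [j ≡ c mod q − 1] with c = [b − m]. By Lucas' theorem (C(p n, ·) ≡ C(n, ·) on multiples
-- of p, plus Vandermonde) this is ≡ Σ_j C(N, j) w(j) mod p with N = r − m as a number.
-- As C(q, j) ≡ [j = 0] + [j = q] mod p and w has period q − 1, Pascal's rule shows that raising
-- the top index by q has the same effect as raising it by 1; so N may be replaced by
-- [N] = [a − m] = A. Finally Σ_j C(A, j) w(j) = w(0) + C(A, c) because A, c ∈ [1, q − 1],
-- and w(0) = 1 exactly when c = q − 1, i.e. when every base-p digit of c is p − 1.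

module Submission where

open import Defs
open import Data.Nat
open import Data.Nat.Properties
open import Data.Nat.Combinatorics using (_C_; k>n⇒nCk≡0; nCk+nC[k+1]≡[n+1]C[k+1]; nC1≡n; nCn≡1)
open import Data.Nat.DivMod
open import Data.Nat.Divisibility using (_∣_; _∣?_; divides; ∣⇒≤; ∣-refl; _∣0; ∣m⇒∣m*n; n∣m*n)
open import Data.Nat.Primality using (Prime; euclidsLemma; prime⇒nonZero; prime⇒nonTrivial)
open import Data.Nat.ListAction using (sum)
open import Data.Nat.Tactic.RingSolver using (solve-∀)
open import Data.Integer as ℤ using (ℤ; +_; _-_)
import Data.Integer.Properties as ℤP
open import Data.Integer.DivMod using (n%ℕd<d; a≡a%ℕn+[a/ℕn]*n)
open import Data.Integer.Divisibility.Signed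
  using (∣ᵤ⇒∣; ∣⇒∣ᵤ; ∣m∣n⇒∣m+n; ∣m∣n⇒∣m-n; ∣m⇒∣-m; ∣n⇒∣m*n)
  renaming (_∣_ to _∣ᶻ_; ∣-refl to ∣ᶻ-refl)
open import Data.Integer.Tactic.RingSolver using () renaming (solve-∀ to solveℤ-∀)
open import Data.Fin using (Fin; zero; suc; toℕ)
open import Data.Fin.Properties using (all?)
open import Data.List using (map; applyUpTo)
open import Data.Vec.Functional using (_∷_; tail)
open import Data.Bool using (Bool; true; false; if_then_else_)
open import Data.Empty using (⊥-elim)
open import Data.Sum using (inj₁; inj₂)
open import Function using (_∘_)
open import Level using (0ℓ)
open import Relation.Nullary using (Dec; yes; no; ¬_)
open import Relation.Nullary.Decidable using (⌊_⌋)
open import Relation.Binary.Bundles using (Setoid)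
open import Relation.Binary.PropositionalEquality
import Relation.Binary.Reasoning.Setoid as SetoidReasoning

∑< : ℕ → (ℕ → ℕ) → ℕ
∑< zero    g = 0
∑< (suc n) g = g 0 + ∑< n (g ∘ suc)

syntax ∑< n (λ k → e) = ∑[ k < n ] e

∑-cong : ∀ n {g h : ℕ → ℕ} → (∀ k → k < n → g k ≡ h k) → ∑< n g ≡ ∑< n h
∑-cong zero    eq = refl
∑-cong (suc n) eq = cong₂ _+_ (eq 0 z<s) (∑-cong n (λ k k<n → eq (suc k) (s<s k<n)))

∑-zero : ∀ n {g : ℕ → ℕ} → (∀ k → k < n → g k ≡ 0) → ∑< n g ≡ 0
∑-zero zero    eq = refl
∑-zero (suc n) eq = cong₂ _+_ (eq 0 z<s) (∑-zero n (λ k k<n → eq (suc k) (s<s k<n)))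

∑-single : ∀ n i (G : ℕ → ℕ) → (∀ k → k < n → k ≢ i → G k ≡ 0) → (n ≤ i → G i ≡ 0) → ∑< n G ≡ G i
∑-single zero    i       G off out = sym (out z≤n)
∑-single (suc n) zero    G off out =
  trans (cong (λ t → G 0 + t) (∑-zero n (λ k k<n → off (suc k) (s<s k<n) (λ ())))) (+-identityʳ (G 0))
∑-single (suc n) (suc i) G off out =
  trans (cong (_+ ∑< n (G ∘ suc)) (off 0 z<s (λ ())))
        (∑-single n i (G ∘ suc) (λ k k<n k≢i → off (suc k) (s<s k<n) (k≢i ∘ suc-injective)) (out ∘ s≤s))

∑-distrib-+ : ∀ n (g h : ℕ → ℕ) → ∑[ k < n ] (g k + h k) ≡ ∑< n g + ∑< n h
∑-distrib-+ zero    g h = refl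
∑-distrib-+ (suc n) g h = begin
  (g 0 + h 0) + ∑[ k < n ] (g (suc k) + h (suc k))  ≡⟨ cong (λ t → (g 0 + h 0) + t) (∑-distrib-+ n (g ∘ suc) (h ∘ suc)) ⟩
  (g 0 + h 0) + (∑< n (g ∘ suc) + ∑< n (h ∘ suc))   ≡⟨ +-assoc-swap (g 0) (h 0) _ _ ⟩
  (g 0 + ∑< n (g ∘ suc)) + (h 0 + ∑< n (h ∘ suc))   ∎
  where
  open ≡-Reasoning
  +-assoc-swap : ∀ a b c d → (a + b) + (c + d) ≡ (a + c) + (b + d)
  +-assoc-swap = solve-∀

*-distribˡ-∑ : ∀ c n (g : ℕ → ℕ) → c * ∑< n g ≡ ∑[ k < n ] (c * g k)
*-distribˡ-∑ c zero    g = *-zeroʳ c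
*-distribˡ-∑ c (suc n) g = trans (*-distribˡ-+ c (g 0) _) (cong (λ t → c * g 0 + t) (*-distribˡ-∑ c n (g ∘ suc)))

∑-snoc : ∀ n (g : ℕ → ℕ) → ∑< (suc n) g ≡ ∑< n g + g n
∑-snoc zero    g = +-identityʳ (g 0)
∑-snoc (suc n) g = trans (cong (λ t → g 0 + t) (∑-snoc n (g ∘ suc))) (sym (+-assoc (g 0) _ _))

∑-split : ∀ m n (g : ℕ → ℕ) → ∑< (m + n) g ≡ ∑< m g + ∑[ k < n ] g (m + k)
∑-split zero    n g = refl
∑-split (suc m) n g = trans (cong (λ t → g 0 + t) (∑-split m n (g ∘ suc))) (sym (+-assoc (g 0) _ _))

sum-map-applyUpTo : ∀ n (g f : ℕ → ℕ) → sum (map g (applyUpTo f n)) ≡ ∑[ k < n ] g (f k)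
sum-map-applyUpTo zero    g f = refl
sum-map-applyUpTo (suc n) g f = cong (λ t → g (f 0) + t) (sum-map-applyUpTo n g (f ∘ suc))

pascal : ∀ n k → suc n C suc k ≡ n C k + n C suc k
pascal n k = sym (nCk+nC[k+1]≡[n+1]C[k+1] n k)

[1+k]*[1+n]C[1+k]≡[1+n]*nCk : ∀ n k → suc k * (suc n C suc k) ≡ suc n * (n C k)
[1+k]*[1+n]C[1+k]≡[1+n]*nCk n zero = trans (+-identityʳ _) (trans (nC1≡n (suc n)) (sym (*-identityʳ (suc n))))
[1+k]*[1+n]C[1+k]≡[1+n]*nCk zero (suc k) =
  trans (cong (suc (suc k) *_) (k>n⇒nCk≡0 {n = 1} {k = suc (suc k)} (s<s z<s))) (*-zeroʳ (suc (suc k)))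
[1+k]*[1+n]C[1+k]≡[1+n]*nCk (suc n) (suc k) = begin
  suc (suc k) * (suc (suc n) C suc (suc k))
    ≡⟨ cong (suc (suc k) *_) (pascal (suc n) (suc k)) ⟩
  suc (suc k) * (suc n C suc k + suc n C suc (suc k))
    ≡⟨ expand k (suc n C suc k) _ ⟩
  (suc k * (suc n C suc k) + suc n C suc k) + suc (suc k) * (suc n C suc (suc k))
    ≡⟨ cong₂ (λ x y → (x + suc n C suc k) + y) ([1+k]*[1+n]C[1+k]≡[1+n]*nCk n k) ([1+k]*[1+n]C[1+k]≡[1+n]*nCk n (suc k)) ⟩
  (suc n * (n C k) + suc n C suc k) + suc n * (n C suc k)
    ≡⟨ cong (λ x → (suc n * (n C k) + x) + suc n * (n C suc k)) (pascal n k) ⟩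
  (suc n * (n C k) + (n C k + n C suc k)) + suc n * (n C suc k)
    ≡⟨ collect n (n C k) (n C suc k) ⟩
  suc (suc n) * (n C k + n C suc k)
    ≡⟨ cong (suc (suc n) *_) (pascal n k) ⟨
  suc (suc n) * (suc n C suc k) ∎
  where
  open ≡-Reasoning
  expand : ∀ k x y → suc (suc k) * (x + y) ≡ (suc k * x + x) + suc (suc k) * y
  expand = solve-∀
  collect : ∀ n x y → (suc n * x + (x + y)) + suc n * y ≡ suc (suc n) * (x + y)
  collect = solve-∀

nC[m+k]*[m+k]Cm≡nCm*[n∸m]Ck : ∀ n m k → m ≤ n → (n C (m + k)) * ((m + k) C m) ≡ (n C m) * ((n ∸ m) C k)
nC[m+k]*[m+k]Cm≡nCm*[n∸m]Ck n zero k _ = trans (*-identityʳ (n C k)) (sym (*-identityˡ (n C k)))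
nC[m+k]*[m+k]Cm≡nCm*[n∸m]Ck (suc n) (suc m) k (s≤s m≤n) = *-cancelˡ-≡ _ _ (suc m) (begin
  suc m * (x * y)                             ≡⟨ rotate (suc m) x y ⟩
  x * (suc m * y)                             ≡⟨ cong (x *_) ([1+k]*[1+n]C[1+k]≡[1+n]*nCk (m + k) m) ⟩
  x * (suc (m + k) * ((m + k) C m))           ≡⟨ regroup x (suc (m + k)) ((m + k) C m) ⟩
  (suc (m + k) * x) * ((m + k) C m)           ≡⟨ cong (_* ((m + k) C m)) ([1+k]*[1+n]C[1+k]≡[1+n]*nCk n (m + k)) ⟩
  (suc n * (n C (m + k))) * ((m + k) C m)     ≡⟨ *-assoc (suc n) (n C (m + k)) ((m + k) C m) ⟩
  suc n * ((n C (m + k)) * ((m + k) C m))     ≡⟨ cong (suc n *_) (nC[m+k]*[m+k]Cm≡nCm*[n∸m]Ck n m k m≤n) ⟩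
  suc n * ((n C m) * ((n ∸ m) C k))           ≡⟨ *-assoc (suc n) (n C m) ((n ∸ m) C k) ⟨
  (suc n * (n C m)) * ((n ∸ m) C k)           ≡⟨ cong (_* ((n ∸ m) C k)) ([1+k]*[1+n]C[1+k]≡[1+n]*nCk n m) ⟨
  (suc m * (suc n C suc m)) * ((n ∸ m) C k)   ≡⟨ *-assoc (suc m) (suc n C suc m) ((n ∸ m) C k) ⟩
  suc m * ((suc n C suc m) * ((n ∸ m) C k))   ∎)
  where
  open ≡-Reasoning
  x = suc n C suc (m + k)
  y = suc (m + k) C suc m
  rotate : ∀ a b c → a * (b * c) ≡ b * (a * c)
  rotate = solve-∀
  regroup : ∀ a b c → a * (b * c) ≡ (b * a) * c
  regroup = solve-∀

p∣pCk : ∀ {p k} → Prime p → 0 < k → k < p → p ∣ p C k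
p∣pCk {suc n} {suc k} isPrime _ k<p
  with euclidsLemma (suc k) (suc n C suc k) isPrime
         (divides (n C k) (trans ([1+k]*[1+n]C[1+k]≡[1+n]*nCk n k) (*-comm (suc n) (n C k))))
... | inj₁ p∣1+k = ⊥-elim (<⇒≱ k<p (∣⇒≤ p∣1+k))
... | inj₂ p∣pCk = p∣pCk

binomialSum : ℕ → (ℕ → ℕ) → ℕ
binomialSum n h = ∑[ k < suc n ] ((n C k) * h k)

binomialSum-cong : ∀ n {g h : ℕ → ℕ} → (∀ k → g k ≡ h k) → binomialSum n g ≡ binomialSum n h
binomialSum-cong n eq = ∑-cong (suc n) (λ k _ → cong ((n C k) *_) (eq k))

binomialSum-distrib-+ : ∀ n (g h : ℕ → ℕ) →
  binomialSum n (λ k → g k + h k) ≡ binomialSum n g + binomialSum n h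
binomialSum-distrib-+ n g h =
  trans (∑-cong (suc n) (λ k _ → *-distribˡ-+ (n C k) (g k) (h k)))
        (∑-distrib-+ (suc n) (λ k → (n C k) * g k) (λ k → (n C k) * h k))

*-distribˡ-binomialSum : ∀ c n (g : ℕ → ℕ) → c * binomialSum n g ≡ binomialSum n (λ k → c * g k)
*-distribˡ-binomialSum c n g = trans (*-distribˡ-∑ c (suc n) (λ k → (n C k) * g k))
  (∑-cong (suc n) (λ k _ → *-left-comm c (n C k) (g k)))
  where
  *-left-comm : ∀ a b c → a * (b * c) ≡ b * (a * c)
  *-left-comm = solve-∀

binomialSum-suc : ∀ n (h : ℕ → ℕ) → binomialSum (suc n) h ≡ binomialSum n (λ k → h k + h (suc k))
binomialSum-suc n h = begin
  1 * h 0 + ∑[ k < suc n ] ((suc n C suc k) * h (suc k))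
    ≡⟨ cong (λ t → 1 * h 0 + t) (∑-cong (suc n) (λ k _ → split k)) ⟩
  1 * h 0 + ∑[ k < suc n ] (lower k + upper k)
    ≡⟨ cong (λ t → 1 * h 0 + t) (∑-distrib-+ (suc n) lower upper) ⟩
  1 * h 0 + (∑< (suc n) lower + ∑< (suc n) upper)
    ≡⟨ cong (λ t → 1 * h 0 + (∑< (suc n) lower + t)) (∑-snoc n upper) ⟩
  1 * h 0 + (∑< (suc n) lower + (∑< n upper + (n C suc n) * h (suc n)))
    ≡⟨ cong (λ t → 1 * h 0 + (∑< (suc n) lower + (∑< n upper + t * h (suc n)))) (k>n⇒nCk≡0 (n<1+n n)) ⟩
  1 * h 0 + (∑< (suc n) lower + (∑< n upper + 0))
    ≡⟨ reorder (1 * h 0) (∑< (suc n) lower) (∑< n upper) ⟩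
  binomialSum n h + binomialSum n (h ∘ suc)
    ≡⟨ binomialSum-distrib-+ n h (h ∘ suc) ⟨
  binomialSum n (λ k → h k + h (suc k)) ∎
  where
  open ≡-Reasoning
  lower upper : ℕ → ℕ
  lower k = (n C k) * h (suc k)
  upper k = (n C suc k) * h (suc k)
  split : ∀ k → (suc n C suc k) * h (suc k) ≡ lower k + upper k
  split k = trans (cong (_* h (suc k)) (pascal n k)) (*-distribʳ-+ (h (suc k)) (n C k) (n C suc k))
  reorder : ∀ a s t → a + (s + (t + 0)) ≡ (a + t) + s
  reorder = solve-∀

binomialSum-+ : ∀ m n (h : ℕ → ℕ) →
  binomialSum (m + n) h ≡ binomialSum m (λ k → binomialSum n (λ t → h (k + t)))
binomialSum-+ zero    n h = sym (trans (+-identityʳ _) (+-identityʳ _))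
binomialSum-+ (suc m) n h = begin
  binomialSum (suc m + n) h
    ≡⟨ binomialSum-suc (m + n) h ⟩
  binomialSum (m + n) (λ k → h k + h (suc k))
    ≡⟨ binomialSum-+ m n (λ k → h k + h (suc k)) ⟩
  binomialSum m (λ k → binomialSum n (λ t → h (k + t) + h (suc k + t)))
    ≡⟨ binomialSum-cong m (λ k → binomialSum-distrib-+ n (λ t → h (k + t)) (λ t → h (suc k + t))) ⟩
  binomialSum m (λ k → binomialSum n (λ t → h (k + t)) + binomialSum n (λ t → h (suc k + t)))
    ≡⟨ binomialSum-suc m (λ k → binomialSum n (λ t → h (k + t))) ⟨
  binomialSum (suc m) (λ k → binomialSum n (λ t → h (k + t))) ∎
  where open ≡-Reasoning

∑-C*C : ∀ r m → m ≤ r → (φ : ℕ → ℕ) →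
  ∑[ l < suc r ] (((r C l) * (l C m)) * φ l) ≡ (r C m) * binomialSum (r ∸ m) (λ k → φ (m + k))
∑-C*C r m m≤r φ = begin
  ∑< (suc r) g
    ≡⟨ cong (λ n → ∑< n g) (sym (trans (+-suc m (r ∸ m)) (cong suc (m+[n∸m]≡n m≤r)))) ⟩
  ∑< (m + suc (r ∸ m)) g
    ≡⟨ ∑-split m (suc (r ∸ m)) g ⟩
  ∑< m g + ∑[ k < suc (r ∸ m) ] g (m + k)
    ≡⟨ cong (_+ ∑[ k < suc (r ∸ m) ] g (m + k)) (∑-zero m below-m) ⟩
  ∑[ k < suc (r ∸ m) ] g (m + k)
    ≡⟨ ∑-cong (suc (r ∸ m)) (λ k _ → subset-of-subset k) ⟩
  ∑[ k < suc (r ∸ m) ] ((r C m) * (((r ∸ m) C k) * φ (m + k)))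
    ≡⟨ *-distribˡ-∑ (r C m) (suc (r ∸ m)) (λ k → ((r ∸ m) C k) * φ (m + k)) ⟨
  (r C m) * binomialSum (r ∸ m) (λ k → φ (m + k)) ∎
  where
  open ≡-Reasoning
  g = λ l → ((r C l) * (l C m)) * φ l
  subset-of-subset : ∀ k → g (m + k) ≡ (r C m) * (((r ∸ m) C k) * φ (m + k))
  subset-of-subset k = trans (cong (_* φ (m + k)) (nC[m+k]*[m+k]Cm≡nCm*[n∸m]Ck r m k m≤r))
                             (*-assoc (r C m) ((r ∸ m) C k) (φ (m + k)))
  below-m : ∀ l → l < m → g l ≡ 0
  below-m l l<m rewrite k>n⇒nCk≡0 l<m | *-zeroʳ (r C l) = refl

-- `x ≡ y [mod n ]` unfolds to a divisibility of a computed integer, from which x and y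
-- cannot be inferred; this record wrapper restores inference.
record _≈_[mod_] (x y n : ℕ) : Set where
  constructor ≈-mod
  field ≡-mod : x ≡ y [mod n ]

open _≈_[mod_] public

module _ {n : ℕ} where

  private
    ≈⇒∣ᶻ : ∀ {x y} → x ≈ y [mod n ] → + n ∣ᶻ + x - + y
    ≈⇒∣ᶻ x≈y = ∣ᵤ⇒∣ (≡-mod x≈y)

    ∣ᶻ⇒≈ : ∀ {x y} → + n ∣ᶻ + x - + y → x ≈ y [mod n ]
    ∣ᶻ⇒≈ n∣x-y = ≈-mod (∣⇒∣ᵤ n∣x-y)

  mod-refl : ∀ {x} → x ≈ x [mod n ]
  mod-refl {x} = ∣ᶻ⇒≈ (subst (+ n ∣ᶻ_) (sym (ℤP.+-inverseʳ (+ x))) (∣ᵤ⇒∣ (n ∣0)))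

  ≡⇒≈-mod : ∀ {x y} → x ≡ y → x ≈ y [mod n ]
  ≡⇒≈-mod refl = mod-refl

  mod-sym : ∀ {x y} → x ≈ y [mod n ] → y ≈ x [mod n ]
  mod-sym {x} {y} x≈y = ∣ᶻ⇒≈ (subst (+ n ∣ᶻ_) (swap (+ x) (+ y)) (∣m⇒∣-m (≈⇒∣ᶻ x≈y)))
    where
    swap : ∀ a b → ℤ.- (a - b) ≡ b - a
    swap = solveℤ-∀

  mod-trans : ∀ {x y z} → x ≈ y [mod n ] → y ≈ z [mod n ] → x ≈ z [mod n ]
  mod-trans {x} {y} {z} x≈y y≈z =
    ∣ᶻ⇒≈ (subst (+ n ∣ᶻ_) (telescope (+ x) (+ y) (+ z)) (∣m∣n⇒∣m+n (≈⇒∣ᶻ x≈y) (≈⇒∣ᶻ y≈z)))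
    where
    telescope : ∀ a b c → (a - b) ℤ.+ (b - c) ≡ a - c
    telescope = solveℤ-∀

  mod-+-cong : ∀ {x y u v} → x ≈ y [mod n ] → u ≈ v [mod n ] → (x + u) ≈ y + v [mod n ]
  mod-+-cong {x} {y} {u} {v} x≈y u≈v =
    ∣ᶻ⇒≈ (subst (+ n ∣ᶻ_) eq (∣m∣n⇒∣m+n (≈⇒∣ᶻ x≈y) (≈⇒∣ᶻ u≈v)))
    where
    regroup : ∀ a b c d → (a - b) ℤ.+ (c - d) ≡ (a ℤ.+ c) - (b ℤ.+ d)
    regroup = solveℤ-∀
    eq : (+ x - + y) ℤ.+ (+ u - + v) ≡ + (x + u) - + (y + v)
    eq = trans (regroup (+ x) (+ y) (+ u) (+ v)) (sym (cong₂ _-_ (ℤP.pos-+ x u) (ℤP.pos-+ y v)))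

  mod-*-cong : ∀ {x y u v} → x ≈ y [mod n ] → u ≈ v [mod n ] → (x * u) ≈ y * v [mod n ]
  mod-*-cong {x} {y} {u} {v} x≈y u≈v =
    ∣ᶻ⇒≈ (subst (+ n ∣ᶻ_) eq
      (∣m∣n⇒∣m+n (∣n⇒∣m*n (+ u) (≈⇒∣ᶻ x≈y)) (∣n⇒∣m*n (+ y) (≈⇒∣ᶻ u≈v))))
    where
    regroup : ∀ a b c d → c ℤ.* (a - b) ℤ.+ b ℤ.* (c - d) ≡ a ℤ.* c - b ℤ.* d
    regroup = solveℤ-∀
    eq : + u ℤ.* (+ x - + y) ℤ.+ + y ℤ.* (+ u - + v) ≡ + (x * u) - + (y * v)
    eq = trans (regroup (+ x) (+ y) (+ u) (+ v)) (sym (cong₂ _-_ (ℤP.pos-* x u) (ℤP.pos-* y v)))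

  ∣⇒≈0-mod : ∀ {x} → n ∣ x → x ≈ 0 [mod n ]
  ∣⇒≈0-mod {x} n∣x = ≈-mod (subst (n ∣_) (cong ℤ.∣_∣ (sym (ℤP.+-identityʳ (+ x)))) n∣x)

≈-mod-setoid : ℕ → Setoid 0ℓ 0ℓ
≈-mod-setoid n = record
  { Carrier       = ℕ
  ; _≈_           = _≈_[mod n ]
  ; isEquivalence = record { refl = mod-refl ; sym = mod-sym ; trans = mod-trans }
  }

∑-cong-mod : ∀ {d} n {g h : ℕ → ℕ} → (∀ k → k < n → g k ≈ h k [mod d ]) → ∑< n g ≈ ∑< n h [mod d ]
∑-cong-mod zero    eq = mod-refl
∑-cong-mod (suc n) eq = mod-+-cong (eq 0 z<s) (∑-cong-mod n (λ k k<n → eq (suc k) (s<s k<n)))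

binomialSum-cong-mod : ∀ {d} n {g h : ℕ → ℕ} → (∀ k → g k ≈ h k [mod d ]) →
  binomialSum n g ≈ binomialSum n h [mod d ]
binomialSum-cong-mod n {g} {h} eq =
  ∑-cong-mod (suc n) {λ k → (n C k) * g k} {λ k → (n C k) * h k} (λ k _ → mod-*-cong (mod-refl {x = n C k}) (eq k))

-- Binomial sums modulo p

binomialSum-prime : ∀ {p} → Prime p → ∀ h → binomialSum p h ≈ h 0 + h p [mod p ]
binomialSum-prime {suc n} isPrime h = begin
  1 * h 0 + ∑< (suc n) inner
    ≡⟨ cong (λ t → 1 * h 0 + t) (∑-snoc n inner) ⟩
  1 * h 0 + (∑< n inner + inner n)
    ≈⟨ mod-+-cong (mod-refl {x = 1 * h 0}) (mod-+-cong inner≈0 (mod-refl {x = inner n})) ⟩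
  1 * h 0 + (0 + (suc n C suc n) * h (suc n))
    ≡⟨ cong (λ c → 1 * h 0 + c * h (suc n)) (nCn≡1 (suc n)) ⟩
  1 * h 0 + 1 * h (suc n)
    ≡⟨ cong₂ _+_ (*-identityˡ (h 0)) (*-identityˡ (h (suc n))) ⟩
  h 0 + h (suc n) ∎
  where
  open SetoidReasoning (≈-mod-setoid (suc n))
  inner : ℕ → ℕ
  inner k = (suc n C suc k) * h (suc k)
  inner≈0 : ∑< n inner ≈ 0 [mod suc n ]
  inner≈0 = mod-trans
    (∑-cong-mod n {inner} {λ _ → 0} (λ k k<n → ∣⇒≈0-mod (∣m⇒∣m*n (h (suc k)) (p∣pCk isPrime z<s (s<s k<n)))))
    (≡⇒≈-mod (∑-zero n (λ _ _ → refl)))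

binomialSum-p* : ∀ {p} → Prime p → ∀ n g →
  binomialSum (p * n) g ≈ binomialSum n (λ j → g (p * j)) [mod p ]
binomialSum-p* {p} isPrime zero g rewrite *-zeroʳ p = mod-refl
binomialSum-p* {p} isPrime (suc n) g = begin
  binomialSum (p * suc n) g
    ≡⟨ cong (λ x → binomialSum x g) (*-suc p n) ⟩
  binomialSum (p + p * n) g
    ≡⟨ binomialSum-+ p (p * n) g ⟩
  binomialSum p (λ k → binomialSum (p * n) (λ t → g (k + t)))
    ≈⟨ binomialSum-prime isPrime (λ k → binomialSum (p * n) (λ t → g (k + t))) ⟩
  binomialSum (p * n) g + binomialSum (p * n) (λ t → g (p + t))
    ≈⟨ mod-+-cong (binomialSum-p* isPrime n g) (binomialSum-p* isPrime n (λ t → g (p + t))) ⟩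
  binomialSum n (λ j → g (p * j)) + binomialSum n (λ j → g (p + p * j))
    ≡⟨ binomialSum-distrib-+ n (λ j → g (p * j)) (λ j → g (p + p * j)) ⟨
  binomialSum n (λ j → g (p * j) + g (p + p * j))
    ≡⟨ binomialSum-cong n (λ j → cong (λ x → g (p * j) + g x) (*-suc p j)) ⟨
  binomialSum n (λ j → g (p * j) + g (p * suc j))
    ≡⟨ binomialSum-suc n (λ j → g (p * j)) ⟨
  binomialSum (suc n) (λ j → g (p * j)) ∎
  where open SetoidReasoning (≈-mod-setoid p)

binomialSum-p^ : ∀ {p} → Prime p → ∀ f h → binomialSum (p ^ f) h ≈ h 0 + h (p ^ f) [mod p ]
binomialSum-p^ isPrime zero h = ≡⇒≈-mod (unit (h 0) (h 1))
  where
  unit : ∀ a b → 1 * a + (1 * b + 0) ≡ a + b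
  unit = solve-∀
binomialSum-p^ {p} isPrime (suc f) h = begin
  binomialSum (p * p ^ f) h
    ≈⟨ binomialSum-p* isPrime (p ^ f) h ⟩
  binomialSum (p ^ f) (λ j → h (p * j))
    ≈⟨ binomialSum-p^ isPrime f (λ j → h (p * j)) ⟩
  h (p * 0) + h (p * p ^ f)
    ≡⟨ cong (λ x → h x + h (p * p ^ f)) (*-zeroʳ p) ⟩
  h 0 + h (p * p ^ f) ∎
  where open SetoidReasoning (≈-mod-setoid p)

-- Sums over digit boxes and Lucas' theorem

boxSum-suc : ∀ f r F → boxSum (suc f) r F ≡ ∑[ l₀ < suc (r zero) ] boxSum f (tail r) (λ l → F (l₀ ∷ l))
boxSum-suc f r F = sum-map-applyUpTo (suc (r zero)) _ (λ k → k)

boxSum-cong : ∀ f r {F G : (Fin f → ℕ) → ℕ} → (∀ l → F l ≡ G l) → boxSum f r F ≡ boxSum f r G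
boxSum-cong zero    r eq = eq _
boxSum-cong (suc f) r {F} {G} eq = begin
  boxSum (suc f) r F
    ≡⟨ boxSum-suc f r F ⟩
  ∑[ l₀ < suc (r zero) ] boxSum f (tail r) (λ l → F (l₀ ∷ l))
    ≡⟨ ∑-cong (suc (r zero)) (λ l₀ _ → boxSum-cong f (tail r) (λ l → eq (l₀ ∷ l))) ⟩
  ∑[ l₀ < suc (r zero) ] boxSum f (tail r) (λ l → G (l₀ ∷ l))
    ≡⟨ boxSum-suc f r G ⟨
  boxSum (suc f) r G ∎
  where open ≡-Reasoning

*-distribˡ-boxSum : ∀ c f r (F : (Fin f → ℕ) → ℕ) → c * boxSum f r F ≡ boxSum f r (λ l → c * F l)
*-distribˡ-boxSum c zero    r F = refl
*-distribˡ-boxSum c (suc f) r F = begin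
  c * boxSum (suc f) r F
    ≡⟨ cong (c *_) (boxSum-suc f r F) ⟩
  c * ∑[ l₀ < suc (r zero) ] boxSum f (tail r) (λ l → F (l₀ ∷ l))
    ≡⟨ *-distribˡ-∑ c (suc (r zero)) (λ l₀ → boxSum f (tail r) (λ l → F (l₀ ∷ l))) ⟩
  ∑[ l₀ < suc (r zero) ] (c * boxSum f (tail r) (λ l → F (l₀ ∷ l)))
    ≡⟨ ∑-cong (suc (r zero)) (λ l₀ _ → *-distribˡ-boxSum c f (tail r) (λ l → F (l₀ ∷ l))) ⟩
  ∑[ l₀ < suc (r zero) ] boxSum f (tail r) (λ l → c * F (l₀ ∷ l))
    ≡⟨ boxSum-suc f r (λ l → c * F l) ⟨
  boxSum (suc f) r (λ l → c * F l) ∎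
  where open ≡-Reasoning

boxSum-factor : ∀ f r (c : ℕ → ℕ) (F : ℕ → (Fin f → ℕ) → ℕ) →
  boxSum (suc f) r (λ l → c (l zero) * F (l zero) (tail l))
    ≡ ∑[ l₀ < suc (r zero) ] (c l₀ * boxSum f (tail r) (F l₀))
boxSum-factor f r c F = trans (boxSum-suc f r (λ l → c (l zero) * F (l zero) (tail l)))
  (∑-cong (suc (r zero)) (λ l₀ _ → sym (*-distribˡ-boxSum (c l₀) f (tail r) (F l₀))))

val-+ : ∀ p f (x y : Fin f → ℕ) → val p f (λ i → x i + y i) ≡ val p f x + val p f y
val-+ p zero    x y = refl
val-+ p (suc f) x y = trans (cong (λ v → x zero + y zero + p * v) (val-+ p f (x ∘ suc) (y ∘ suc)))
                            (distrib p (x zero) (y zero) _ _)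
  where
  distrib : ∀ p a b c d → a + b + p * (c + d) ≡ (a + p * c) + (b + p * d)
  distrib = solve-∀

val-∸ : ∀ p f (x y : Fin f → ℕ) → (∀ i → y i ≤ x i) → val p f (λ i → x i ∸ y i) ≡ val p f x ∸ val p f y
val-∸ p f x y y≤x = begin
  val p f (λ i → x i ∸ y i)                        ≡⟨ m+n∸n≡m _ (val p f y) ⟨
  val p f (λ i → x i ∸ y i) + val p f y ∸ val p f y ≡⟨ cong (_∸ val p f y) (val-+ p f (λ i → x i ∸ y i) y) ⟨
  val p f (λ i → x i ∸ y i + y i) ∸ val p f y       ≡⟨ cong (λ v → v ∸ val p f y) (val-cong (λ i → m∸n+n≡m (y≤x i))) ⟩
  val p f x ∸ val p f y                            ∎
  where
  open ≡-Reasoning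
  val-cong : ∀ {f} {u v : Fin f → ℕ} → (∀ i → u i ≡ v i) → val p f u ≡ val p f v
  val-cong {zero}  eq = refl
  val-cong {suc f} eq = cong₂ (λ a b → a + p * b) (eq zero) (val-cong (eq ∘ suc))

digitBinomialSum : (p f : ℕ) → (Fin f → ℕ) → (ℕ → ℕ) → ℕ
digitBinomialSum p f s h = boxSum f s (λ k → prodFin f (λ i → s i C k i) * h (val p f k))

digitBinomialSum-cong : ∀ p f s {g h : ℕ → ℕ} → (∀ j → g j ≡ h j) →
  digitBinomialSum p f s g ≡ digitBinomialSum p f s h
digitBinomialSum-cong p f s eq = boxSum-cong f s (λ k → cong (prodFin f (λ i → s i C k i) *_) (eq _))

digitBinomialSum-suc : ∀ p f s h → digitBinomialSum p (suc f) s h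
  ≡ binomialSum (s zero) (λ k₀ → digitBinomialSum p f (tail s) (λ j → h (k₀ + p * j)))
digitBinomialSum-suc p f s h = trans
  (boxSum-cong (suc f) s (λ k → *-assoc (s zero C k zero) (prodFin f (λ i → s (suc i) C k (suc i))) (h (val p (suc f) k))))
  (boxSum-factor f s (s zero C_) (λ k₀ k → prodFin f (λ i → s (suc i) C k i) * h (k₀ + p * val p f k)))

lucas : ∀ {p} → Prime p → ∀ f s h → digitBinomialSum p f s h ≈ binomialSum (val p f s) h [mod p ]
lucas isPrime zero    s h = ≡⇒≈-mod (sym (+-identityʳ _))
lucas {p} isPrime (suc f) s h = begin
  digitBinomialSum p (suc f) s h
    ≡⟨ digitBinomialSum-suc p f s h ⟩
  binomialSum (s zero) (λ k → digitBinomialSum p f (tail s) (λ j → h (k + p * j)))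
    ≈⟨ binomialSum-cong-mod (s zero) (λ k → mod-trans (lucas isPrime f (tail s) (λ j → h (k + p * j)))
                                        (mod-sym (binomialSum-p* isPrime (val p f (tail s)) (λ t → h (k + t))))) ⟩
  binomialSum (s zero) (λ k → binomialSum (p * val p f (tail s)) (λ t → h (k + t)))
    ≡⟨ binomialSum-+ (s zero) (p * val p f (tail s)) h ⟨
  binomialSum (val p (suc f) s) h ∎
  where open SetoidReasoning (≈-mod-setoid p)

boxSum-C*C : ∀ p f (r m : Fin f → ℕ) → (∀ i → m i ≤ r i) → ∀ (h : ℕ → ℕ) →
  boxSum f r (λ l → (prodFin f (λ i → r i C l i) * prodFin f (λ i → l i C m i)) * h (val p f l))
    ≡ prodFin f (λ i → r i C m i) * digitBinomialSum p f (λ i → r i ∸ m i) (λ j → h (val p f m + j))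
boxSum-C*C p zero    r m m≤r h = sym (*-identityˡ _)
boxSum-C*C p (suc f) r m m≤r h = begin
  boxSum (suc f) r (λ l → (prodFin (suc f) (λ i → r i C l i) * prodFin (suc f) (λ i → l i C m i)) * h (val p (suc f) l))
    ≡⟨ boxSum-cong (suc f) r (λ l → shuffle (r₀ C l zero) (∏rC (tail l)) (l zero C m₀) (∏Cm (tail l)) (h (val p (suc f) l))) ⟩
  boxSum (suc f) r (λ l → c (l zero) * F (l zero) (tail l))
    ≡⟨ boxSum-factor f r c F ⟩
  ∑[ l₀ < suc r₀ ] (c l₀ * boxSum f (tail r) (F l₀))
    ≡⟨ ∑-cong (suc r₀) (λ l₀ _ →
         cong (c l₀ *_) (boxSum-C*C p f (tail r) (tail m) (m≤r ∘ suc) (λ j → h (l₀ + p * j)))) ⟩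
  ∑[ l₀ < suc r₀ ] (c l₀ * ψ l₀)
    ≡⟨ ∑-C*C r₀ m₀ (m≤r zero) ψ ⟩
  (r₀ C m₀) * binomialSum s₀ (λ k → ψ (m₀ + k))
    ≡⟨ cong ((r₀ C m₀) *_)
         (*-distribˡ-binomialSum ∏rCm s₀ (λ k → digitBinomialSum p f s′ (λ j → h (m₀ + k + p * (vm′ + j))))) ⟨
  (r₀ C m₀) * (∏rCm * binomialSum s₀ (λ k → digitBinomialSum p f s′ (λ j → h (m₀ + k + p * (vm′ + j)))))
    ≡⟨ cong (λ x → (r₀ C m₀) * (∏rCm * x))
         (binomialSum-cong s₀ (λ k → digitBinomialSum-cong p f s′ (λ j → cong h (regroup m₀ k vm′ j)))) ⟩
  (r₀ C m₀) * (∏rCm * binomialSum s₀ (λ k → digitBinomialSum p f s′ (λ j → h (m₀ + p * vm′ + (k + p * j)))))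
    ≡⟨ *-assoc (r₀ C m₀) ∏rCm _ ⟨
  ((r₀ C m₀) * ∏rCm) * binomialSum s₀ (λ k → digitBinomialSum p f s′ (λ j → h (m₀ + p * vm′ + (k + p * j))))
    ≡⟨ cong (((r₀ C m₀) * ∏rCm) *_) (digitBinomialSum-suc p f (λ i → r i ∸ m i) (λ j → h (val p (suc f) m + j))) ⟨
  prodFin (suc f) (λ i → r i C m i) * digitBinomialSum p (suc f) (λ i → r i ∸ m i) (λ j → h (val p (suc f) m + j)) ∎
  where
  open ≡-Reasoning
  r₀ = r zero
  m₀ = m zero
  s₀ = r₀ ∸ m₀
  s′ = λ i → r (suc i) ∸ m (suc i)
  vm′ = val p f (tail m)
  ∏rC ∏Cm : (Fin f → ℕ) → ℕ
  ∏rC l = prodFin f (λ i → r (suc i) C l i)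
  ∏Cm l = prodFin f (λ i → l i C m (suc i))
  ∏rCm = prodFin f (λ i → r (suc i) C m (suc i))
  c : ℕ → ℕ
  c l₀ = (r₀ C l₀) * (l₀ C m₀)
  F : ℕ → (Fin f → ℕ) → ℕ
  F l₀ l = (∏rC l * ∏Cm l) * h (l₀ + p * val p f l)
  ψ : ℕ → ℕ
  ψ l₀ = ∏rCm * digitBinomialSum p f s′ (λ j → h (l₀ + p * (vm′ + j)))
  shuffle : ∀ a b c d e → ((a * b) * (c * d)) * e ≡ (a * c) * ((b * d) * e)
  shuffle = solve-∀
  regroup : ∀ m₀ k v j → m₀ + k + p * (v + j) ≡ m₀ + p * v + (k + p * j)
  regroup = regroupAt p
    where
    regroupAt : ∀ q m₀ k v j → m₀ + k + q * (v + j) ≡ m₀ + q * v + (k + q * j)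
    regroupAt = solve-∀

if-dec-cong : ∀ {A B : Set} (a? : Dec A) (b? : Dec B) → (A → B) → (B → A) → ∀ {x y : ℕ} →
  (if ⌊ a? ⌋ then x else y) ≡ (if ⌊ b? ⌋ then x else y)
if-dec-cong (yes _) (yes _) _    _    = refl
if-dec-cong (no _)  (no _)  _    _    = refl
if-dec-cong (yes a) (no ¬b) a→b  _    = ⊥-elim (¬b (a→b a))
if-dec-cong (no ¬a) (yes b) _    b→a  = ⊥-elim (¬a (b→a b))

divIndicator : ℕ → ℤ → ℕ
divIndicator d z = if ⌊ d ∣? ℤ.∣ z ∣ ⌋ then 1 else 0

divIndicator-cong : ∀ {d} z z′ → + d ∣ᶻ z - z′ → divIndicator d z ≡ divIndicator d z′
divIndicator-cong {d} z z′ d∣z-z′ = if-dec-cong (d ∣? ℤ.∣ z ∣) (d ∣? ℤ.∣ z′ ∣)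
  (λ d∣z → ∣⇒∣ᵤ (subst (+ d ∣ᶻ_) (cancel z z′) (∣m∣n⇒∣m-n (∣ᵤ⇒∣ {i = z} d∣z) d∣z-z′)))
  (λ d∣z′ → ∣⇒∣ᵤ (subst (+ d ∣ᶻ_) (add z z′) (∣m∣n⇒∣m+n d∣z-z′ (∣ᵤ⇒∣ {i = z′} d∣z′))))
  where
  cancel : ∀ a b → a - (a - b) ≡ b
  cancel = solveℤ-∀
  add : ∀ a b → (a - b) ℤ.+ b ≡ a
  add = solveℤ-∀

divIndicator-yes : ∀ {d z} → + d ∣ᶻ z → divIndicator d z ≡ 1
divIndicator-yes {d} {z} d∣z with d ∣? ℤ.∣ z ∣
... | yes _   = refl
... | no d∤z = ⊥-elim (d∤z (∣⇒∣ᵤ d∣z))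

divIndicator-no : ∀ {d z} → ¬ (+ d ∣ᶻ z) → divIndicator d z ≡ 0
divIndicator-no {d} {z} d∤z with d ∣? ℤ.∣ z ∣
... | yes d∣z = ⊥-elim (d∤z (∣ᵤ⇒∣ d∣z))
... | no _    = refl

divIndicator-periodic : ∀ d j z → divIndicator d (+ (d + j) - z) ≡ divIndicator d (+ j - z)
divIndicator-periodic d j z = divIndicator-cong (+ (d + j) - z) (+ j - z) (subst (+ d ∣ᶻ_) (sym eq) ∣ᶻ-refl)
  where
  cancel : ∀ d j z → (d ℤ.+ j - z) - (j - z) ≡ d
  cancel = solveℤ-∀
  eq : (+ (d + j) - z) - (+ j - z) ≡ + d
  eq = trans (cong (λ x → (x - z) - (+ j - z)) (ℤP.pos-+ d j)) (cancel (+ d) (+ j) z)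

divIndicator-shift : ∀ {d v b c} → + d ∣ᶻ (+ b - + v) - + c → ∀ j →
  divIndicator d (+ (v + j) - + b) ≡ divIndicator d (+ j - + c)
divIndicator-shift {d} {v} {b} {c} d∣b-v-c j =
  divIndicator-cong (+ (v + j) - + b) (+ j - + c) (subst (+ d ∣ᶻ_) eq (∣m⇒∣-m d∣b-v-c))
  where
  regroup : ∀ v j b c → ℤ.- ((b - v) - c) ≡ (v ℤ.+ j - b) - (j - c)
  regroup = solveℤ-∀
  eq : ℤ.- ((+ b - + v) - + c) ≡ (+ (v + j) - + b) - (+ j - + c)
  eq = trans (regroup (+ v) (+ j) (+ b) (+ c)) (cong (λ x → (x - + b) - (+ j - + c)) (sym (ℤP.pos-+ v j)))

1≤bracket : ∀ d .{{_ : NonZero d}} z → 1 ≤ bracket d z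
1≤bracket (suc k) z = s≤s z≤n

bracket≤d : ∀ d .{{_ : NonZero d}} z → bracket d z ≤ d
bracket≤d (suc k) z = n%ℕd<d (z - ℤ.1ℤ) (suc k)

bracket-suc : ∀ d .{{_ : NonZero d}} n → bracket d (+ suc n) ≡ suc (n % d)
bracket-suc (suc k) n = refl

∣ᶻ-bracket : ∀ d .{{_ : NonZero d}} z → + d ∣ᶻ z - + bracket d z
∣ᶻ-bracket d@(suc k) z = subst (+ d ∣ᶻ_) (sym eq) (∣n⇒∣m*n q ∣ᶻ-refl)
  where
  r = (z - ℤ.1ℤ) ℤ.%ℕ d
  q = (z - ℤ.1ℤ) ℤ./ℕ d
  shift : ∀ z r → z - (ℤ.1ℤ ℤ.+ r) ≡ (z - ℤ.1ℤ) - r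
  shift = solveℤ-∀
  cancel : ∀ r x → (r ℤ.+ x) - r ≡ x
  cancel = solveℤ-∀
  eq : z - + suc r ≡ q ℤ.* + d
  eq = begin
    z - + suc r                     ≡⟨ cong (z -_) (ℤP.pos-+ 1 r) ⟩
    z - (ℤ.1ℤ ℤ.+ + r)              ≡⟨ shift z (+ r) ⟩
    (z - ℤ.1ℤ) - + r                ≡⟨ cong (_- + r) (a≡a%ℕn+[a/ℕn]*n (z - ℤ.1ℤ) d) ⟩
    (+ r ℤ.+ q ℤ.* + d) - + r       ≡⟨ cancel (+ r) (q ℤ.* + d) ⟩
    q ℤ.* + d                       ∎
    where open ≡-Reasoning

private
  <∧∣⇒≡0 : ∀ {d} x → x < d → d ∣ x → x ≡ 0
  <∧∣⇒≡0 zero    _   _   = refl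
  <∧∣⇒≡0 (suc x) x<d d∣x = ⊥-elim (<⇒≱ x<d (∣⇒≤ d∣x))

  residue-unique-≤ : ∀ {d c c′} → 1 ≤ c′ → c′ ≤ c → c ≤ d → + d ∣ᶻ + c - + c′ → c ≡ c′
  residue-unique-≤ {d} {c} {c′} 1≤c′ c′≤c c≤d d∣c-c′ =
    ≤-antisym (m∸n≡0⇒m≤n (<∧∣⇒≡0 (c ∸ c′) gap<d d∣gap)) c′≤c
    where
    gap<d : c ∸ c′ < d
    gap<d = <-≤-trans (∸-monoʳ-< {o = 0} 1≤c′ c′≤c) c≤d
    d∣gap : d ∣ c ∸ c′
    d∣gap = subst (λ x → d ∣ ℤ.∣ x ∣) (trans (ℤP.m-n≡m⊖n c c′) (ℤP.⊖-≥ c′≤c)) (∣⇒∣ᵤ d∣c-c′)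

residue-unique : ∀ {d c c′} → 1 ≤ c → c ≤ d → 1 ≤ c′ → c′ ≤ d → + d ∣ᶻ + c - + c′ → c ≡ c′
residue-unique {d} {c} {c′} 1≤c c≤d 1≤c′ c′≤d d∣c-c′ with ≤-total c′ c
... | inj₁ c′≤c = residue-unique-≤ 1≤c′ c′≤c c≤d d∣c-c′
... | inj₂ c≤c′ =
  sym (residue-unique-≤ 1≤c c≤c′ c′≤d (subst (+ d ∣ᶻ_) (swap (+ c) (+ c′)) (∣m⇒∣-m d∣c-c′)))
  where
  swap : ∀ a b → ℤ.- (a - b) ≡ b - a
  swap = solveℤ-∀

bracket-cong : ∀ d .{{_ : NonZero d}} {z z′} → + d ∣ᶻ z - z′ → bracket d z ≡ bracket d z′
bracket-cong d {z} {z′} d∣z-z′ = residue-unique (1≤bracket d z) (bracket≤d d z) (1≤bracket d z′) (bracket≤d d z′)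
  (subst (+ d ∣ᶻ_) (regroup z z′ (+ bracket d z) (+ bracket d z′))
    (∣m∣n⇒∣m+n (∣m∣n⇒∣m-n d∣z-z′ (∣ᶻ-bracket d z)) (∣ᶻ-bracket d z′)))
  where
  regroup : ∀ z z′ c c′ → ((z - z′) - (z - c)) ℤ.+ (z′ - c′) ≡ c - c′
  regroup = solveℤ-∀

bracket[a-v]≡bracket[r∸v] : ∀ d .{{_ : NonZero d}} {a r v} → r ≡ a [mod d ] → v ≤ r →
  bracket d (+ a - + v) ≡ bracket d (+ (r ∸ v))
bracket[a-v]≡bracket[r∸v] d {a} {r} {v} r≡a v≤r = bracket-cong d (subst (+ d ∣ᶻ_) eq (∣m⇒∣-m (∣ᵤ⇒∣ r≡a)))
  where
  regroup : ∀ a r v → ℤ.- (r - a) ≡ (a - v) - (r - v)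
  regroup = solveℤ-∀
  eq : ℤ.- (+ r - + a) ≡ (+ a - + v) - + (r ∸ v)
  eq = trans (regroup (+ a) (+ r) (+ v)) (cong ((+ a - + v) -_) (trans (ℤP.m-n≡m⊖n r v) (ℤP.⊖-≥ v≤r)))

binomialSum-divIndicator : ∀ {d A c} → A ≤ d → 1 ≤ c → c ≤ d →
  binomialSum A (λ j → divIndicator d (+ j - + c)) ≡ divIndicator d (+ 0 - + c) + A C c
binomialSum-divIndicator {d} {A} {suc c′} A≤d 1≤c c≤d = cong₂ _+_ (*-identityˡ (g 0))
  (begin
    ∑[ k < A ] ((A C suc k) * g (suc k))  ≡⟨ ∑-single A c′ (λ k → (A C suc k) * g (suc k)) off out ⟩
    (A C suc c′) * g (suc c′)             ≡⟨ cong ((A C suc c′) *_) (divIndicator-yes c∣0) ⟩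
    (A C suc c′) * 1                      ≡⟨ *-identityʳ (A C suc c′) ⟩
    A C suc c′                            ∎)
  where
  open ≡-Reasoning
  g : ℕ → ℕ
  g j = divIndicator d (+ j - + suc c′)
  c∣0 : + d ∣ᶻ + suc c′ - + suc c′
  c∣0 = subst (+ d ∣ᶻ_) (sym (ℤP.+-inverseʳ (+ suc c′))) (∣ᵤ⇒∣ (d ∣0))
  off : ∀ k → k < A → k ≢ c′ → (A C suc k) * g (suc k) ≡ 0
  off k k<A k≢c′ = trans (cong ((A C suc k) *_)
    (divIndicator-no (λ d∣ → k≢c′ (suc-injective (residue-unique (s≤s z≤n) (≤-trans k<A A≤d) 1≤c c≤d d∣)))))
    (*-zeroʳ (A C suc k))
  out : A ≤ c′ → (A C suc c′) * g (suc c′) ≡ 0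
  out A≤c′ = cong (_* g (suc c′)) (k>n⇒nCk≡0 (s≤s A≤c′))

-- Binomial sums of a function of period p ^ f ∸ 1

module _ {p f d : ℕ} (isPrime : Prime p) (p^f≡1+d : p ^ f ≡ suc d)
         {w : ℕ → ℕ} (w-periodic : ∀ j → w (d + j) ≡ w j) where
  open SetoidReasoning (≈-mod-setoid p)

  binomialSum-p^f+ : ∀ n → binomialSum (p ^ f + n) w ≈ binomialSum (suc n) w [mod p ]
  binomialSum-p^f+ n = begin
    binomialSum (p ^ f + n) w
      ≡⟨ binomialSum-+ (p ^ f) n w ⟩
    binomialSum (p ^ f) (λ k → binomialSum n (λ t → w (k + t)))
      ≈⟨ binomialSum-p^ isPrime f (λ k → binomialSum n (λ t → w (k + t))) ⟩
    binomialSum n w + binomialSum n (λ t → w (p ^ f + t))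
      ≡⟨ cong (λ t → binomialSum n w + t) (binomialSum-cong n w[p^f+t]≡w[1+t]) ⟩
    binomialSum n w + binomialSum n (w ∘ suc)
      ≡⟨ binomialSum-distrib-+ n w (w ∘ suc) ⟨
    binomialSum n (λ t → w t + w (suc t))
      ≡⟨ binomialSum-suc n w ⟨
    binomialSum (suc n) w ∎
    where
    w[p^f+t]≡w[1+t] : ∀ t → w (p ^ f + t) ≡ w (suc t)
    w[p^f+t]≡w[1+t] t = trans (cong w (trans (cong (_+ t) p^f≡1+d) (sym (+-suc d t)))) (w-periodic (suc t))

  binomialSum-+t*d : ∀ n t → binomialSum (suc (n + t * d)) w ≈ binomialSum (suc n) w [mod p ]
  binomialSum-+t*d n zero    = ≡⇒≈-mod (cong (λ x → binomialSum (suc x) w) (+-identityʳ n))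
  binomialSum-+t*d n (suc t) = begin
    binomialSum (suc (n + (d + t * d))) w
      ≡⟨ cong (λ x → binomialSum x w) (trans (regroup n d (t * d)) (cong (λ x → n + t * d + x) (sym p^f≡1+d))) ⟩
    binomialSum (n + t * d + p ^ f) w
      ≡⟨ cong (λ x → binomialSum x w) (+-comm (n + t * d) (p ^ f)) ⟩
    binomialSum (p ^ f + (n + t * d)) w
      ≈⟨ binomialSum-p^f+ (n + t * d) ⟩
    binomialSum (suc (n + t * d)) w
      ≈⟨ binomialSum-+t*d n t ⟩
    binomialSum (suc n) w ∎
    where
    regroup : ∀ n d x → suc (n + (d + x)) ≡ n + x + suc d
    regroup = solve-∀

  binomialSum-bracket : .{{_ : NonZero d}} → ∀ {n} → 0 < n →
    binomialSum n w ≈ binomialSum (bracket d (+ n)) w [mod p ]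
  binomialSum-bracket {suc n} _ = begin
    binomialSum (suc n) w
      ≡⟨ cong (λ x → binomialSum (suc x) w) (m≡m%n+[m/n]*n n d) ⟩
    binomialSum (suc (n % d + (n / d) * d)) w
      ≈⟨ binomialSum-+t*d (n % d) (n / d) ⟩
    binomialSum (suc (n % d)) w
      ≡⟨ cong (λ x → binomialSum x w) (bracket-suc d n) ⟨
    binomialSum (bracket d (+ suc n)) w ∎

-- The base-p digits of p ^ f ∸ 1

private
  [1+k]*q∸1≡k+[q∸1]*[1+k] : ∀ k q → 1 ≤ q → suc k * q ∸ 1 ≡ k + (q ∸ 1) * suc k
  [1+k]*q∸1≡k+[q∸1]*[1+k] k (suc e) _ = swap k e
    where
    swap : ∀ k e → e + k * suc e ≡ k + e * suc k
    swap = solve-∀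

digit-p^f∸1 : ∀ p .{{_ : NonZero p}} f (i : Fin f) → digit p (p ^ f ∸ 1) (toℕ i) ≡ p ∸ 1
digit-p^f∸1 p@(suc k) (suc f) i rewrite [1+k]*q∸1≡k+[q∸1]*[1+k] k (p ^ f) (m^n>0 p f) with i
... | zero  = trans ([m+kn]%n≡m%n k (p ^ f ∸ 1) p) (m<n⇒m%n≡m (n<1+n k))
... | suc i = trans (cong (λ x → digit p x (toℕ i)) top) (digit-p^f∸1 p f i)
  where
  top : (k + (p ^ f ∸ 1) * p) / p ≡ p ^ f ∸ 1
  top = begin
    (k + (p ^ f ∸ 1) * p) / p      ≡⟨ +-distrib-/-∣ʳ k (n∣m*n (p ^ f ∸ 1)) ⟩
    k / p + (p ^ f ∸ 1) * p / p    ≡⟨ cong₂ _+_ (m<n⇒m/n≡0 (n<1+n k)) (m*n/n≡m (p ^ f ∸ 1) p) ⟩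
    p ^ f ∸ 1                      ∎
    where open ≡-Reasoning

digits-p∸1⇒≡p^f∸1 : ∀ p .{{_ : NonZero p}} f c → c < p ^ f →
  (∀ (i : Fin f) → digit p c (toℕ i) ≡ p ∸ 1) → c ≡ p ^ f ∸ 1
digits-p∸1⇒≡p^f∸1 p       zero    c c<1 _      = n<1⇒n≡0 c<1
digits-p∸1⇒≡p^f∸1 p@(suc k) (suc f) c c<p^f digits = begin
  c                              ≡⟨ m≡m%n+[m/n]*n c p ⟩
  c % p + (c / p) * p            ≡⟨ cong₂ (λ x y → x + y * p) (digits zero) quotient ⟩
  k + (p ^ f ∸ 1) * p            ≡⟨ [1+k]*q∸1≡k+[q∸1]*[1+k] k (p ^ f) (m^n>0 p f) ⟨
  p * p ^ f ∸ 1                  ∎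
  where
  open ≡-Reasoning
  quotient : c / p ≡ p ^ f ∸ 1
  quotient = digits-p∸1⇒≡p^f∸1 p f (c / p)
    (m<n*o⇒m/o<n (subst (c <_) (*-comm p (p ^ f)) c<p^f)) (λ i → digits (suc i))

1+[p^f∸1]≡p^f : ∀ p .{{_ : NonZero p}} f → suc (p ^ f ∸ 1) ≡ p ^ f
1+[p^f∸1]≡p^f p f = m+[n∸m]≡n (m^n>0 p f)

1≤p^f∸1 : ∀ {p f} → Prime p → 1 ≤ f → 1 ≤ p ^ f ∸ 1
1≤p^f∸1 {p} {f} isPrime 1≤f = ∸-monoˡ-≤ 1 (begin
  2       ≤⟨ nonTrivial⇒n>1 p ⟩
  p       ≡⟨ ^-identityʳ p ⟨
  p ^ 1   ≤⟨ ^-monoʳ-≤ p 1≤f ⟩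
  p ^ f   ∎)
  where
  open ≤-Reasoning
  instance
    _ = prime⇒nonZero isPrime
    _ = prime⇒nonTrivial isPrime

divIndicator-[-c]≡delta : ∀ p .{{_ : NonZero p}} f c → 1 ≤ c → c ≤ p ^ f ∸ 1 →
  divIndicator (p ^ f ∸ 1) (+ 0 - + c) ≡ delta p f c
divIndicator-[-c]≡delta p f c 1≤c c≤d =
  if-dec-cong (d ∣? ℤ.∣ + 0 - + c ∣) (all? (λ i → digit p c (toℕ i) ≟ p ∸ 1)) d∣c⇒digits digits⇒d∣c
  where
  d = p ^ f ∸ 1
  ∣-c∣≡c : ℤ.∣ + 0 - + c ∣ ≡ c
  ∣-c∣≡c = trans (cong ℤ.∣_∣ (ℤP.+-identityˡ (ℤ.- + c))) (ℤP.∣-i∣≡∣i∣ (+ c))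
  d∣c⇒digits : d ∣ ℤ.∣ + 0 - + c ∣ → ∀ i → digit p c (toℕ i) ≡ p ∸ 1
  d∣c⇒digits d∣c i = subst (λ x → digit p x (toℕ i) ≡ p ∸ 1) (sym c≡d) (digit-p^f∸1 p f i)
    where
    instance _ = >-nonZero 1≤c
    c≡d : c ≡ d
    c≡d = ≤-antisym c≤d (∣⇒≤ (subst (d ∣_) ∣-c∣≡c d∣c))
  digits⇒d∣c : (∀ i → digit p c (toℕ i) ≡ p ∸ 1) → d ∣ ℤ.∣ + 0 - + c ∣
  digits⇒d∣c digits = subst (d ∣_) (sym (trans ∣-c∣≡c c≡d)) ∣-refl
    where
    c≡d : c ≡ d
    c≡d = digits-p∸1⇒≡p^f∸1 p f c (≤-trans (s≤s c≤d) (≤-reflexive (1+[p^f∸1]≡p^f p f))) digits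

if-then-else-0 : ∀ (t : Bool) x → (if t then x else 0) ≡ x * (if t then 1 else 0)
if-then-else-0 true  x = sym (*-identityʳ x)
if-then-else-0 false x = sym (*-zeroʳ x)

S≡∏C*digitBinomialSum : ∀ p f r b m → (∀ i → m i ≤ r i) →
  S p f r b m ≡ prodFin f (λ i → r i C m i) *
    digitBinomialSum p f (λ i → r i ∸ m i) (λ j → divIndicator (p ^ f ∸ 1) (+ (val p f m + j) - + b))
S≡∏C*digitBinomialSum p f r b m m≤r = trans
  (boxSum-cong f r (λ l → if-then-else-0 _ (prodFin f (λ i → r i C l i) * prodFin f (λ i → l i C m i))))
  (boxSum-C*C p f r m m≤r (λ x → divIndicator (p ^ f ∸ 1) (+ x - + b)))

lemma6p2 : (p f : ℕ) → Prime p → 1 ≤ f →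
    (r : Fin f → ℕ) → (a : ℕ) → 1 ≤ a → a ≤ p ^ f ∸ 1 →
    val p f r ≡ a [mod p ^ f ∸ 1 ] →
    (m : Fin f → ℕ) → (∀ i → m i ≤ r i) → val p f m < val p f r →
    (b : ℕ) → 1 ≤ b → b ≤ p ^ f ∸ 1 →
    S p f r b m ≡
      prodFin f (λ i → r i C m i) *
        ((bracket (p ^ f ∸ 1) (+ a - + val p f m) C bracket (p ^ f ∸ 1) (+ b - + val p f m))
          + delta p f (bracket (p ^ f ∸ 1) (+ b - + val p f m)))
      [mod p ]
lemma6p2 p f isPrime 1≤f r a _ _ r≡a m m≤r vm<vr b _ _ = ≡-mod (begin
  S p f r b m
    ≡⟨ S≡∏C*digitBinomialSum p f r b m m≤r ⟩
  P * digitBinomialSum p f s (λ j → divIndicator d (+ (vm + j) - + b))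
    ≡⟨ cong (P *_) (digitBinomialSum-cong p f s (divIndicator-shift {d} {vm} {b} {c} (∣ᶻ-bracket d (+ b - + vm)))) ⟩
  P * digitBinomialSum p f s w
    ≈⟨ mod-*-cong (mod-refl {x = P}) (lucas isPrime f s w) ⟩
  P * binomialSum (val p f s) w
    ≡⟨ cong (λ n → P * binomialSum n w) (val-∸ p f r m m≤r) ⟩
  P * binomialSum (val p f r ∸ vm) w
    ≈⟨ mod-*-cong (mod-refl {x = P}) (binomialSum-bracket {f = f} isPrime p^f≡1+d {w} w-periodic (m<n⇒0<n∸m vm<vr)) ⟩
  P * binomialSum (bracket d (+ (val p f r ∸ vm))) w
    ≡⟨ cong (λ n → P * binomialSum n w) (bracket[a-v]≡bracket[r∸v] d r≡a (<⇒≤ vm<vr)) ⟨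
  P * binomialSum A w
    ≡⟨ cong (P *_) (binomialSum-divIndicator (bracket≤d d (+ a - + vm)) (1≤bracket d (+ b - + vm)) (bracket≤d d (+ b - + vm))) ⟩
  P * (divIndicator d (+ 0 - + c) + (A C c))
    ≡⟨ cong (λ x → P * (x + (A C c))) (divIndicator-[-c]≡delta p f c (1≤bracket d (+ b - + vm)) (bracket≤d d (+ b - + vm))) ⟩
  P * (delta p f c + (A C c))
    ≡⟨ cong (P *_) (+-comm (delta p f c) (A C c)) ⟩
  P * ((A C c) + delta p f c) ∎)
  where
  open SetoidReasoning (≈-mod-setoid p)
  d = p ^ f ∸ 1
  instance
    _ = prime⇒nonZero isPrime
    _ = >-nonZero (1≤p^f∸1 isPrime 1≤f)
  p^f≡1+d : p ^ f ≡ suc d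
  p^f≡1+d = sym (1+[p^f∸1]≡p^f p f)
  vm = val p f m
  s = λ i → r i ∸ m i
  P = prodFin f (λ i → r i C m i)
  A = bracket d (+ a - + vm)
  c = bracket d (+ b - + vm)
  w = λ j → divIndicator d (+ j - + c)
  w-periodic : ∀ j → w (d + j) ≡ w j
  w-periodic j = divIndicator-periodic d j (+ c)
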